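{- Let $k\ge0$ be an integer. Then: $h(k+1)=h(k)$ if $k$ is even, and $h(k+1)\le h(k)+1$ if $k$ is odd; $h(k+2)=h(k)+1$ if $k\equiv0,1\pmod 4$, and $h(k+2)\le h(k)$ if $k\equiv2,3\pmod 4$; $h(k+3)\le h(k)+1$; $h(k+4)\le h(k)+1$.
   Context: For an integer $k\ge0$ with binary expansion $k=\sum_{i\ge0}\beta_i2^i$, $h(k)=\sum_{i\ge1}\beta_i2^{\lfloor (i-1)/2\rfloor}$. -}

module Defs where

open import Data.Nat using (ℕ; zero; suc; _+_; _*_; _^_)
open import Data.Nat.DivMod using (_/_; _%_)
open import Data.Nat.Properties using ()

β : ℕ → ℕ → ℕ
β i k = (k / 2 ^ i) % 2
  where instance _ = Data.Nat.Properties.m^n≢0 2 i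

hSum : ℕ → ℕ → ℕ
hSum zero    k = 0
hSum (suc n) k = hSum n k + β (suc n) k * 2 ^ (n / 2)

-- h(k) = Σ_{i≥1} β_i 2^⌊(i-1)/2⌋ ; all digits with index i > k vanish
-- (since k < 2^i), so truncating the sum at i = k is exact.
h : ℕ → ℕ
h k = hSum k k

{-# OPTIONS --safe #-}
module Submission where

-- Since h ignores the lowest bit, h k = g ⌊k/2⌋ where g m = h (2m) = Σ_j bit_j(m) 2^⌊j/2⌋.
-- Thus g (4t + r) = (number of ones in r) + 2 g t for r < 4, so g (m + 1) - g m is
-- +1, 0, +1 for r = 0, 1, 2, while for r = 3 it is 2 (g (t + 1) - g t) - 2 ≤ 0 by induction
-- on t. Finally h (k + j) = g (⌊k/2⌋ + i) with i ∈ {0, 1, 2} fixed by j and the parity of k,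
-- and k mod 4 determines the parity of ⌊k/2⌋.

open import Defs
open import Data.Nat
open import Data.Nat.Properties
open import Data.Nat.DivMod
open import Data.Nat.Divisibility using (divides)
open import Data.Nat.Tactic.RingSolver using (solve-∀)
open import Data.Product using (_×_; _,_)
open import Data.Sum using (_⊎_; inj₁; inj₂)
open import Relation.Nullary using (contradiction)
open import Relation.Binary.PropositionalEquality

[m+kn]/n≡m/n+k : ∀ m k n .{{_ : NonZero n}} → (m + k * n) / n ≡ m / n + k
[m+kn]/n≡m/n+k m k n = trans (+-distrib-/-∣ʳ m (divides k refl)) (cong (m / n +_) (m*n/n≡m k n))

m%2≡0⊎m%2≡1 : ∀ m → m % 2 ≡ 0 ⊎ m % 2 ≡ 1
m%2≡0⊎m%2≡1 m with m % 2 | m%n<n m 2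
... | 0 | _ = inj₁ refl
... | 1 | _ = inj₂ refl
... | suc (suc _) | s≤s (s≤s ())

n<2^n : ∀ n → n < 2 ^ n
n<2^n zero    = z<s
n<2^n (suc n) = +-mono-≤ (m^n>0 2 n) (≤-trans (n<2^n n) (m≤m+n (2 ^ n) 0))

β-suc : ∀ i k → β (suc i) k ≡ β i (k / 2)
β-suc i k = cong (_% 2) (sym (m/n/o≡m/[n*o] k 2 (2 ^ i) {{_}} {{m^n≢0 2 i}} {{m^n≢0 2 (suc i)}}))

k<2^i⇒β≡0 : ∀ i {k} → k < 2 ^ i → β i k ≡ 0
k<2^i⇒β≡0 i k<2^i = cong (_% 2) (m<n⇒m/n≡0 {{m^n≢0 2 i}} k<2^i)

hSum-suc : ∀ {n k} → k ≤ n → hSum (suc n) k ≡ hSum n k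
hSum-suc {n} {k} k≤n = begin
  hSum n k + β (suc n) k * 2 ^ (n / 2) ≡⟨ cong (λ b → hSum n k + b * 2 ^ (n / 2)) (k<2^i⇒β≡0 (suc n) k<2^1+n) ⟩
  hSum n k + 0                         ≡⟨ +-identityʳ (hSum n k) ⟩
  hSum n k                             ∎
  where
  open ≡-Reasoning
  k<2^1+n : k < 2 ^ suc n
  k<2^1+n = <-trans (s≤s k≤n) (n<2^n (suc n))

hSum-stable : ∀ {n k} → k ≤ n → hSum n k ≡ h k
hSum-stable k≤n = go (≤⇒≤′ k≤n)
  where
  go : ∀ {n k} → k ≤′ n → hSum n k ≡ h k
  go ≤′-refl        = refl
  go (≤′-step k≤′n) = trans (hSum-suc (≤′⇒≤ k≤′n)) (go k≤′n)

hSum-cong-/2 : ∀ n {k l} → k / 2 ≡ l / 2 → hSum n k ≡ hSum n l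
hSum-cong-/2 zero    k/2≡l/2 = refl
hSum-cong-/2 (suc n) {k} {l} k/2≡l/2 = cong₂ (λ s b → s + b * 2 ^ (n / 2)) (hSum-cong-/2 n k/2≡l/2) β≡
  where
  β≡ : β (suc n) k ≡ β (suc n) l
  β≡ = trans (β-suc n k) (trans (cong (β n) k/2≡l/2) (sym (β-suc n l)))

hSum-unfold : ∀ n k → hSum (2 + n) k ≡ β 1 k + β 2 k + 2 * hSum n (k / 4)
hSum-unfold zero k = rearrange (β 1 k) (β 2 k)
  where
  rearrange : ∀ a b → 0 + a * 1 + b * 1 ≡ a + b + 2 * 0
  rearrange = solve-∀
hSum-unfold (suc n) k = begin
  hSum (2 + n) k + β (3 + n) k * 2 ^ ((2 + n) / 2)
    ≡⟨ cong₂ (λ s b → s + b * 2 ^ ((2 + n) / 2)) (hSum-unfold n k) β[3+n] ⟩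
  β 1 k + β 2 k + 2 * hSum n (k / 4) + β (suc n) (k / 4) * 2 ^ ((2 + n) / 2)
    ≡⟨ cong (λ e → β 1 k + β 2 k + 2 * hSum n (k / 4) + β (suc n) (k / 4) * 2 ^ e) (+-distrib-/-∣ˡ {2} n {2} (divides 1 refl)) ⟩
  β 1 k + β 2 k + 2 * hSum n (k / 4) + β (suc n) (k / 4) * 2 ^ (1 + n / 2)
    ≡⟨ rearrange (β 1 k + β 2 k) (hSum n (k / 4)) (β (suc n) (k / 4)) (2 ^ (n / 2)) ⟩
  β 1 k + β 2 k + 2 * (hSum n (k / 4) + β (suc n) (k / 4) * 2 ^ (n / 2))
    ∎
  where
  open ≡-Reasoning
  β[3+n] : β (3 + n) k ≡ β (suc n) (k / 4)
  β[3+n] = trans (β-suc (2 + n) k) (trans (β-suc (suc n) (k / 2)) (cong (β (suc n)) (m/n/o≡m/[n*o] k 2 2)))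
  rearrange : ∀ a s b p → a + 2 * s + b * (2 * p) ≡ a + 2 * (s + b * p)
  rearrange = solve-∀

h-cong-/2 : ∀ k l → k / 2 ≡ l / 2 → h k ≡ h l
h-cong-/2 k l k/2≡l/2 = begin
  h k            ≡⟨ hSum-stable (m≤m+n k l) ⟨
  hSum (k + l) k ≡⟨ hSum-cong-/2 (k + l) k/2≡l/2 ⟩
  hSum (k + l) l ≡⟨ hSum-stable (m≤n+m l k) ⟩
  h l            ∎
  where open ≡-Reasoning

h-unfold : ∀ k → h k ≡ β 1 k + β 2 k + 2 * h (k / 4)
h-unfold k = begin
  h k                                   ≡⟨ hSum-stable (m≤n+m k 2) ⟨
  hSum (2 + k) k                        ≡⟨ hSum-unfold k k ⟩
  β 1 k + β 2 k + 2 * hSum k (k / 4)    ≡⟨ cong (λ s → β 1 k + β 2 k + 2 * s) (hSum-stable (m/n≤m k 4)) ⟩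
  β 1 k + β 2 k + 2 * h (k / 4)         ∎
  where open ≡-Reasoning

g : ℕ → ℕ
g m = h (m * 2)

h≡g[k/2] : ∀ k → h k ≡ g (k / 2)
h≡g[k/2] k = h-cong-/2 k (k / 2 * 2) (sym (m*n/n≡m (k / 2) 2))

g-unfold : ∀ m → g m ≡ m % 2 + m / 2 % 2 + 2 * g (m / 4)
g-unfold m = begin
  h (m * 2)                                           ≡⟨ h-unfold (m * 2) ⟩
  β 1 (m * 2) + β 2 (m * 2) + 2 * h (m * 2 / 4)        ≡⟨ cong₂ (λ b₁ b₂ → b₁ + b₂ + 2 * h (m * 2 / 4)) low-bit high-bit ⟩
  m % 2 + m / 2 % 2 + 2 * h (m * 2 / 4)                ≡⟨ cong (λ x → m % 2 + m / 2 % 2 + 2 * x) quarter ⟩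
  m % 2 + m / 2 % 2 + 2 * g (m / 4)                    ∎
  where
  open ≡-Reasoning
  low-bit : β 1 (m * 2) ≡ m % 2
  low-bit = trans (β-suc 0 (m * 2)) (trans (cong (λ x → x / 1 % 2) (m*n/n≡m m 2)) (cong (_% 2) (n/1≡n m)))
  high-bit : β 2 (m * 2) ≡ m / 2 % 2
  high-bit = trans (β-suc 1 (m * 2)) (cong (β 1) (m*n/n≡m m 2))
  quarter : h (m * 2 / 4) ≡ g (m / 4)
  quarter = trans (h≡g[k/2] (m * 2 / 4)) (cong g (trans (cong (_/ 2) (m*n/o*n≡m/o m 2 2)) (m/n/o≡m/[n*o] m 2 2)))

%2-distrib-+ : ∀ m n {a b} → m % 2 ≡ a → n % 2 ≡ b → (m + n) % 2 ≡ (a + b) % 2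
%2-distrib-+ m n m%2≡a n%2≡b = trans (%-distribˡ-+ m n 2) (cong₂ (λ x y → (x + y) % 2) m%2≡a n%2≡b)

[m+k*4]%2≡m%2 : ∀ m k → (m + k * 4) % 2 ≡ m % 2
[m+k*4]%2≡m%2 m k = trans (cong (λ x → (m + x) % 2) (sym (*-assoc k 2 2))) ([m+kn]%n≡m%n m (k * 2) 2)

g-digit : ∀ r t → g (r + t * 4) ≡ r % 2 + r / 2 % 2 + 2 * g (r / 4 + t)
g-digit r t = begin
  g m                                        ≡⟨ g-unfold m ⟩
  m % 2 + m / 2 % 2 + 2 * g (m / 4)          ≡⟨ cong₂ (λ b x → b + m / 2 % 2 + 2 * g x) ([m+k*4]%2≡m%2 r t) ([m+kn]/n≡m/n+k r t 4) ⟩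
  r % 2 + m / 2 % 2 + 2 * g (r / 4 + t)      ≡⟨ cong (λ b → r % 2 + b + 2 * g (r / 4 + t)) bit₁ ⟩
  r % 2 + r / 2 % 2 + 2 * g (r / 4 + t)      ∎
  where
  open ≡-Reasoning
  m : ℕ
  m = r + t * 4
  bit₁ : m / 2 % 2 ≡ r / 2 % 2
  bit₁ = begin
    (r + t * 4) / 2 % 2     ≡⟨ cong (λ x → (r + x) / 2 % 2) (sym (*-assoc t 2 2)) ⟩
    (r + t * 2 * 2) / 2 % 2 ≡⟨ cong (_% 2) ([m+kn]/n≡m/n+k r (t * 2) 2) ⟩
    (r / 2 + t * 2) % 2     ≡⟨ [m+kn]%n≡m%n (r / 2) t 2 ⟩
    r / 2 % 2               ∎

-- Least significant digit first; base4-suc adds one with carry, which makes recursion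
-- from 3 + t * 4 to t structural.
data Base4 : ℕ → Set where
  []  : Base4 0
  0∷_ : ∀ {t} → Base4 t → Base4 (t * 4)
  1∷_ : ∀ {t} → Base4 t → Base4 (1 + t * 4)
  2∷_ : ∀ {t} → Base4 t → Base4 (2 + t * 4)
  3∷_ : ∀ {t} → Base4 t → Base4 (3 + t * 4)

base4-suc : ∀ {m} → Base4 m → Base4 (suc m)
base4-suc []     = 1∷ []
base4-suc (0∷ q) = 1∷ q
base4-suc (1∷ q) = 2∷ q
base4-suc (2∷ q) = 3∷ q
base4-suc (3∷ q) = 0∷ base4-suc q

base4 : ∀ m → Base4 m
base4 zero    = []
base4 (suc m) = base4-suc (base4 m)

g[1+4t]≡g[4t]+1 : ∀ t → g (1 + t * 4) ≡ g (t * 4) + 1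
g[1+4t]≡g[4t]+1 t = trans (g-digit 1 t) (trans (+-comm 1 (2 * g t)) (cong (_+ 1) (sym (g-digit 0 t))))

g[2+4t]≡g[1+4t] : ∀ t → g (2 + t * 4) ≡ g (1 + t * 4)
g[2+4t]≡g[1+4t] t = trans (g-digit 2 t) (sym (g-digit 1 t))

g[3+4t]≡g[2+4t]+1 : ∀ t → g (3 + t * 4) ≡ g (2 + t * 4) + 1
g[3+4t]≡g[2+4t]+1 t = trans (g-digit 3 t) (trans (+-comm 1 (1 + 2 * g t)) (cong (_+ 1) (sym (g-digit 2 t))))

g[4+4t]≤g[3+4t] : ∀ t → g (suc t) ≤ g t + 1 → g (4 + t * 4) ≤ g (3 + t * 4)
g[4+4t]≤g[3+4t] t g[1+t]≤g[t]+1 = begin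
  g (4 + t * 4)   ≡⟨ g-digit 4 t ⟩
  2 * g (suc t)   ≤⟨ *-monoʳ-≤ 2 g[1+t]≤g[t]+1 ⟩
  2 * (g t + 1)   ≡⟨ *-distribˡ-+ 2 (g t) 1 ⟩
  2 * g t + 2     ≡⟨ +-comm (2 * g t) 2 ⟩
  2 + 2 * g t     ≡⟨ g-digit 3 t ⟨
  g (3 + t * 4)   ∎
  where open ≤-Reasoning

g-suc-≤ : ∀ m → g (suc m) ≤ g m + 1
g-suc-≤ m = go (base4 m)
  where
  go : ∀ {m} → Base4 m → g (suc m) ≤ g m + 1
  go []          = ≤-refl
  go (0∷_ {t} _) = ≤-reflexive (g[1+4t]≡g[4t]+1 t)
  go (1∷_ {t} _) = ≤-trans (≤-reflexive (g[2+4t]≡g[1+4t] t)) (m≤m+n (g (1 + t * 4)) 1)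
  go (2∷_ {t} _) = ≤-reflexive (g[3+4t]≡g[2+4t]+1 t)
  go (3∷_ {t} q) = ≤-trans (g[4+4t]≤g[3+4t] t (go q)) (m≤m+n (g (3 + t * 4)) 1)

g-suc-even : ∀ m → m % 2 ≡ 0 → g (suc m) ≡ g m + 1
g-suc-even m m-even with base4 m
... | []          = refl
... | 0∷_ {t} _   = g[1+4t]≡g[4t]+1 t
... | 1∷_ {t} _   = contradiction (trans (sym ([m+k*4]%2≡m%2 1 t)) m-even) λ ()
... | 2∷_ {t} _   = g[3+4t]≡g[2+4t]+1 t
... | 3∷_ {t} _   = contradiction (trans (sym ([m+k*4]%2≡m%2 3 t)) m-even) λ ()

g-suc-odd : ∀ m → m % 2 ≡ 1 → g (suc m) ≤ g m
g-suc-odd m m-odd with base4 m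
... | []          = contradiction m-odd λ ()
... | 0∷_ {t} _   = contradiction (trans (sym ([m+k*4]%2≡m%2 0 t)) m-odd) λ ()
... | 1∷_ {t} _   = ≤-reflexive (g[2+4t]≡g[1+4t] t)
... | 2∷_ {t} _   = contradiction (trans (sym ([m+k*4]%2≡m%2 2 t)) m-odd) λ ()
... | 3∷_ {t} _   = g[4+4t]≤g[3+4t] t (g-suc-≤ t)

g-+2-≤ : ∀ m → g (2 + m) ≤ g m + 1
g-+2-≤ m with m%2≡0⊎m%2≡1 m
... | inj₁ m-even = ≤-trans (g-suc-odd (suc m) (%2-distrib-+ 1 m refl m-even)) (≤-reflexive (g-suc-even m m-even))
... | inj₂ m-odd  = ≤-trans (g-suc-≤ (suc m)) (+-monoˡ-≤ 1 (g-suc-odd m m-odd))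

h[k+2n]≡g[n+k/2] : ∀ k n → h (k + n * 2) ≡ g (n + k / 2)
h[k+2n]≡g[n+k/2] k n = trans (h≡g[k/2] (k + n * 2)) (cong g (trans ([m+kn]/n≡m/n+k k n 2) (+-comm (k / 2) n)))

h-suc-even : ∀ k → k % 2 ≡ 0 → h (k + 1) ≡ h k
h-suc-even k k-even = h-cong-/2 (k + 1) k (trans (+-distrib-/ k 1 k%2+1<2) (+-identityʳ (k / 2)))
  where
  k%2+1<2 : k % 2 + 1 % 2 < 2
  k%2+1<2 = subst (λ b → b + 1 < 2) (sym k-even) ≤-refl

h-suc-odd : ∀ k → k % 2 ≡ 1 → h (k + 1) ≡ g (1 + k / 2)
h-suc-odd k k-odd = begin
  h (k + 1)      ≡⟨ h-suc-even (k + 1) (%2-distrib-+ k 1 k-odd refl) ⟨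
  h (k + 1 + 1)  ≡⟨ cong h (+-assoc k 1 1) ⟩
  h (k + 2)      ≡⟨ h[k+2n]≡g[n+k/2] k 1 ⟩
  g (1 + k / 2)  ∎
  where open ≡-Reasoning

h-suc-≤ : ∀ k → h (k + 1) ≤ h k + 1
h-suc-≤ k with m%2≡0⊎m%2≡1 k
... | inj₁ k-even = ≤-trans (≤-reflexive (h-suc-even k k-even)) (m≤m+n (h k) 1)
... | inj₂ k-odd  = begin
  h (k + 1)      ≡⟨ h-suc-odd k k-odd ⟩
  g (1 + k / 2)  ≤⟨ g-suc-≤ (k / 2) ⟩
  g (k / 2) + 1  ≡⟨ cong (_+ 1) (h≡g[k/2] k) ⟨
  h k + 1        ∎
  where open ≤-Reasoning

h-+2-≡ : ∀ k → k / 2 % 2 ≡ 0 → h (k + 2) ≡ h k + 1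
h-+2-≡ k k/2-even = begin
  h (k + 2)      ≡⟨ h[k+2n]≡g[n+k/2] k 1 ⟩
  g (1 + k / 2)  ≡⟨ g-suc-even (k / 2) k/2-even ⟩
  g (k / 2) + 1  ≡⟨ cong (_+ 1) (h≡g[k/2] k) ⟨
  h k + 1        ∎
  where open ≡-Reasoning

h-+2-≤ : ∀ k → k / 2 % 2 ≡ 1 → h (k + 2) ≤ h k
h-+2-≤ k k/2-odd = begin
  h (k + 2)      ≡⟨ h[k+2n]≡g[n+k/2] k 1 ⟩
  g (1 + k / 2)  ≤⟨ g-suc-odd (k / 2) k/2-odd ⟩
  g (k / 2)      ≡⟨ h≡g[k/2] k ⟨
  h k            ∎
  where open ≤-Reasoning

h-+4-≤ : ∀ k → h (k + 4) ≤ h k + 1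
h-+4-≤ k = begin
  h (k + 4)      ≡⟨ h[k+2n]≡g[n+k/2] k 2 ⟩
  g (2 + k / 2)  ≤⟨ g-+2-≤ (k / 2) ⟩
  g (k / 2) + 1  ≡⟨ cong (_+ 1) (h≡g[k/2] k) ⟨
  h k + 1        ∎
  where open ≤-Reasoning

h-+3-≤ : ∀ k → h (k + 3) ≤ h k + 1
h-+3-≤ k with m%2≡0⊎m%2≡1 k
... | inj₁ k-even = begin
  h (k + 3)      ≡⟨ cong h (+-assoc k 2 1) ⟨
  h (k + 2 + 1)  ≡⟨ h-suc-even (k + 2) (%2-distrib-+ k 2 k-even refl) ⟩
  h (k + 2)      ≡⟨ h[k+2n]≡g[n+k/2] k 1 ⟩
  g (1 + k / 2)  ≤⟨ g-suc-≤ (k / 2) ⟩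
  g (k / 2) + 1  ≡⟨ cong (_+ 1) (h≡g[k/2] k) ⟨
  h k + 1        ∎
  where open ≤-Reasoning
... | inj₂ k-odd  = begin
  h (k + 3)      ≡⟨ h-suc-even (k + 3) (%2-distrib-+ k 3 k-odd refl) ⟨
  h (k + 3 + 1)  ≡⟨ cong h (+-assoc k 3 1) ⟩
  h (k + 4)      ≤⟨ h-+4-≤ k ⟩
  h k + 1        ∎
  where open ≤-Reasoning

k%4≡r⇒k/2%2≡r/2 : ∀ k {r} → k % 4 ≡ r → k / 2 % 2 ≡ r / 2
k%4≡r⇒k/2%2≡r/2 k k%4≡r = trans (sym (m%[n*o]/o≡m/o%n k 2 2)) (cong (_/ 2) k%4≡r)

mainTheorem15 : (k : ℕ) →
    ((k % 2 ≡ 0 → h (k + 1) ≡ h k) × (k % 2 ≡ 1 → h (k + 1) ≤ h k + 1))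
    × ((k % 4 ≡ 0 → h (k + 2) ≡ h k + 1) × (k % 4 ≡ 1 → h (k + 2) ≡ h k + 1)
       × (k % 4 ≡ 2 → h (k + 2) ≤ h k) × (k % 4 ≡ 3 → h (k + 2) ≤ h k))
    × (h (k + 3) ≤ h k + 1)
    × (h (k + 4) ≤ h k + 1)
mainTheorem15 k =
  (h-suc-even k , λ _ → h-suc-≤ k) ,
  ( (λ k%4≡0 → h-+2-≡ k (k%4≡r⇒k/2%2≡r/2 k k%4≡0))
  , (λ k%4≡1 → h-+2-≡ k (k%4≡r⇒k/2%2≡r/2 k k%4≡1))
  , (λ k%4≡2 → h-+2-≤ k (k%4≡r⇒k/2%2≡r/2 k k%4≡2))
  , (λ k%4≡3 → h-+2-≤ k (k%4≡r⇒k/2%2≡r/2 k k%4≡3)) ) ,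
  h-+3-≤ k ,
  h-+4-≤ k
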